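{- Let $\ell\ge2$. For each $j=1,2,\dots,\ell$, the set $\widehat{\mathcal L}_j=\{(b|g;f_1,\dots,f_\ell)\in\mathcal{M}a\mathcal{R}: f_j=t\}$ is a subgroup of $\mathcal{M}a\mathcal{R}$. Furthermore, for $\ell=2$: if the Riordan array $(g,f_2)$ belongs to the Appell subgroup of the Riordan group (i.e. $f_2=t$), then $(b|g;t,f_2)$ belongs to the Appell subgroup $\{(b|g;t,t)\}$ of the double almost-Riordan group; and if $(g,f_2)$ belongs to the Bell subgroup of the Riordan group (i.e. $f_2=tg$), then $(b|g;t,f_2)$ belongs to the type-$2$ Bell subgroup $\{(b|g;f_1,f_2): f_2=tg\}$ of the double almost-Riordan group.
   Context: Fix an integer $\ell\ge2$ and a field $\mathbb K$ of characteristic $0$ (e.g. $\mathbb C$); $\mathbb K[[t^\ell]]$ denotes the formal power series in $t^\ell$. For $b,g\in\mathbb K[[t^\ell]]$ with $b(0)\ne0$, $g(0)\ne0$ and $f_1,\dots,f_\ell\in t\mathbb K[[t^\ell]]$ with nonzero coefficient of $t$, the multiple almost-Riordan array $(b|g;f_1,\dots,f_\ell)$ is the infinite lower triangular matrix whose column $0$ has generating function $b$ and whose column $k\ge1$ has generating function $t\,g\,f_1^{e_1(k)}\cdots f_\ell^{e_\ell(k)}$ with $e_i(k)=\lfloor (k-1+\ell-i)/\ell\rfloor$ (columns $b, tg, tgf_1, tgf_1f_2,\dots,tgf_1\cdots f_\ell, tgf_1^2f_2\cdots f_\ell,\dots$). $\mathcal{M}a\mathcal{R}$ is the group of all such arrays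 under matrix multiplication; for $\ell=2$ it is called the double almost-Riordan group. A Riordan array $(g,f)$ (with $g(0)\ne0$, $f(0)=0\ne f'(0)$) is the lower triangular matrix whose $k$-th column has generating function $gf^k$; it lies in the Appell subgroup if $f=t$ and in the Bell subgroup if $f=tg$. -}

module Defs where

open import Level using (_⊔_)
open import Data.Nat using (ℕ; zero; suc; _∸_; _≤_) renaming (_+_ to _+ℕ_)
open import Data.Nat.DivMod using (_/_; _%_)
open import Data.Fin using (Fin; toℕ) renaming (zero to fzero; suc to fsuc)
open import Data.Product using (Σ; _×_; _,_; ∃)
open import Relation.Nullary using (¬_)
open import Relation.Binary.PropositionalEquality using (_≡_; _≢_)
open import Algebra.Bundles using (CommutativeRing)

record Field (c r : Level.Level) : Set (Level.suc (c ⊔ r)) where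
  field
    commutativeRing : CommutativeRing c r
  open CommutativeRing commutativeRing public
  field
    1≉0     : ¬ (1# ≈ 0#)
    inverse : ∀ x → ¬ (x ≈ 0#) → Σ Carrier (λ y → (x * y) ≈ 1#)

module FieldTheory {c r} (F : Field c r) where
  open Field F

  natF : ℕ → Carrier
  natF zero    = 0#
  natF (suc n) = 1# + natF n

  CharacteristicZero : Set r
  CharacteristicZero = ∀ n → ¬ (natF (suc n) ≈ 0#)

  Series : Set c
  Series = ℕ → Carrier

  _≈S_ : Series → Series → Set r
  a ≈S b = ∀ n → a n ≈ b n

  sumTo : ℕ → (ℕ → Carrier) → Carrier
  sumTo zero    h = h 0
  sumTo (suc n) h = sumTo n h + h (suc n)

  oneS : Series
  oneS zero    = 1#
  oneS (suc _) = 0#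

  tS : Series
  tS (suc zero) = 1#
  tS _          = 0#

  _*S_ : Series → Series → Series
  (a *S b) n = sumTo n (λ i → a i * b (n ∸ i))

  _^S_ : Series → ℕ → Series
  a ^S zero  = oneS
  a ^S suc k = a *S (a ^S k)

  prodS : (m : ℕ) → (Fin m → Series) → Series
  prodS zero    h = oneS
  prodS (suc m) h = h fzero *S prodS m (λ i → h (fsuc i))

  -- Infinite lower triangular matrices: entry (row n, column k).

  Matrix : Set c
  Matrix = ℕ → ℕ → Carrier

  _≈M_ : Matrix → Matrix → Set r
  A ≈M B = ∀ n k → A n k ≈ B n k

  identityM : Matrix
  identityM zero    zero    = 1#
  identityM zero    (suc _) = 0#
  identityM (suc _) zero    = 0#
  identityM (suc n) (suc k) = identityM n k

  _·M_ : Matrix → Matrix → Matrix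
  (A ·M B) n k = sumTo n (λ i → A n i * B i k)

  -- floor division with the (irrelevant) convention m / 0 = 0
  _div_ : ℕ → ℕ → ℕ
  m div zero    = 0
  m div (suc d) = m / suc d

  _mod_ : ℕ → ℕ → ℕ
  m mod zero    = m
  m mod (suc d) = m % suc d

  InPowersOf : ℕ → Series → Set r
  InPowersOf ℓ a = ∀ n → n mod ℓ ≢ 0 → a n ≈ 0#

  InTTimesPowersOf : ℕ → Series → Set r
  InTTimesPowersOf ℓ f = ∀ n → n mod ℓ ≢ 1 → f n ≈ 0#

  -- The data (b | g ; f_1, ..., f_ℓ); f_i is  fs i  with i : Fin ℓ  (0-based).
  record MaRData (ℓ : ℕ) : Set (c ⊔ r) where
    field
      b  : Series
      g  : Series
      fs : Fin ℓ → Series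
      b-ser  : InPowersOf ℓ b
      g-ser  : InPowersOf ℓ g
      fs-ser : ∀ i → InTTimesPowersOf ℓ (fs i)
      b0≉0   : ¬ (b 0 ≈ 0#)
      g0≉0   : ¬ (g 0 ≈ 0#)
      fs1≉0  : ∀ i → ¬ (fs i 1 ≈ 0#)

  -- e_i(k) = ⌊(k - 1 + ℓ - i)/ℓ⌋ for k ≥ 1 and i = toℕ i' + 1 ∈ {1,…,ℓ}
  expo : (ℓ : ℕ) → Fin ℓ → ℕ → ℕ
  expo ℓ i' k = ((k ∸ 1) +ℕ (ℓ ∸ suc (toℕ i'))) div ℓ

  column : {ℓ : ℕ} → MaRData ℓ → ℕ → Series
  column {ℓ} d zero    = MaRData.b d
  column {ℓ} d (suc k) =
    (tS *S MaRData.g d) *S prodS ℓ (λ i → MaRData.fs d i ^S expo ℓ i (suc k))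

  array : {ℓ : ℕ} → MaRData ℓ → Matrix
  array d n k = column d k n

  InLhat : {ℓ : ℕ} → Fin ℓ → MaRData ℓ → Set r
  InLhat j d = MaRData.fs d j ≈S tS

  IsSubgroupMaR : {ℓ : ℕ} → (MaRData ℓ → Set r) → Set (c ⊔ r)
  IsSubgroupMaR {ℓ} P =
      (Σ (MaRData ℓ) (λ e → P e × (array e ≈M identityM)))
    × (∀ d₁ d₂ → P d₁ → P d₂ →
         Σ (MaRData ℓ) (λ d₃ → P d₃ × (array d₃ ≈M (array d₁ ·M array d₂))))
    × (∀ d → P d →
         Σ (MaRData ℓ) (λ d' → P d'
            × ((array d ·M array d') ≈M identityM)
            × ((array d' ·M array d) ≈M identityM)))

  f₁ f₂ : MaRData 2 → Series
  f₁ d = MaRData.fs d fzero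
  f₂ d = MaRData.fs d (fsuc fzero)

  InAppellDAR : Matrix → Set (c ⊔ r)
  InAppellDAR M =
    Σ (MaRData 2) (λ d → (f₁ d ≈S tS) × (f₂ d ≈S tS) × (array d ≈M M))

  InBell2DAR : Matrix → Set (c ⊔ r)
  InBell2DAR M =
    Σ (MaRData 2) (λ d → (f₂ d ≈S (tS *S MaRData.g d)) × (array d ≈M M))

module Submission where

-- Write b = b̂(t^ℓ), g = ĝ(t^ℓ) and f_i = t f̂_i(t^ℓ).  Hermite's identity ∑_i e_i(k+1) = k makes
-- column k+1 equal to t^{k+1} Û_k(t^ℓ) with Û_k = ĝ ∏_i f̂_i^{e_i(k+1)}, and since e_i(k+1+qℓ) =
-- e_i(k+1) + q, column k+1+qℓ is column k+1 times P^q, where P = f_1 ⋯ f_ℓ = R(t^ℓ) for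
-- R = t f̂_1 ⋯ f̂_ℓ.  Hence an array sends t^{k+1} V(t^ℓ) to t^{k+1} (Û_k V(R))(t^ℓ), so the product
-- of two arrays is again an array, with ĝ = ĝ₁ ĝ₂(R₁) and f̂_i = f̂₁ᵢ f̂₂ᵢ(R₁); f_j = t means f̂_j = 1
-- and is preserved.  An inverse is found by solving ĝ γ(R) = 1 and f̂_i φ_i(R) = 1 (taking φ_j = 1),
-- which are triangular systems because R has order exactly one, and the column b by forward
-- substitution in the rows and columns divisible by ℓ.  The inverse is two-sided because the
-- right inverse has a right inverse of its own.

open import Defs
open import Level using (Level)
open import Data.Nat using (ℕ; _≤_)
open import Data.Fin using (Fin)
open import Data.Product using (_×_)

open import Algebra.Bundles using (CommutativeMonoid)
open import Relation.Binary.Bundles using (Setoid)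
open import Data.Empty using (⊥-elim)
open import Function using (_∘_)
open import Data.Product using (Σ; _,_; proj₁; proj₂)

open import Data.Bool using (true; false; if_then_else_)
open import Data.Nat using (zero; suc; _<?_; _≤?_; ≢-nonZero⁻¹; _∸_; _<_; _<ᵇ_; z≤n; s≤s; NonZero)
  renaming (_+_ to _+ℕ_; _*_ to _*ℕ_)
import Data.Nat.Properties as ℕ
import Data.Fin.Properties as Fin
open import Data.Nat.DivMod using (_/_; _%_; m≡m%n+[m/n]*n; m%n<n; m*n%n≡0; [m+kn]%n≡m%n; m<n⇒m%n≡m;
  m*n/n≡m; +-distrib-/-∣ʳ; m<n⇒m/n≡0; m/n≡1+[m∸n]/n)
open import Data.Nat.Divisibility using (divides-refl)
open import Data.Fin using (toℕ) renaming (zero to fzero; suc to fsuc)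
open import Data.Sum using (inj₁; inj₂)
open import Relation.Nullary using (yes; no; ofʸ; ofⁿ)
open import Relation.Binary.PropositionalEquality as ≡ using (_≡_; _≢_)
import Algebra.Properties.CommutativeMonoid.Sum as CommutativeMonoidSum
import Algebra.Properties.CommutativeMonoid.Mult as CommutativeMonoidMult
import Algebra.Properties.CommutativeSemigroup as CommutativeSemigroupProperties
import Algebra.Properties.AbelianGroup as AbelianGroupProperties
import Relation.Binary.Reasoning.Setoid as SetoidReasoning

open CommutativeMonoidSum ℕ.+-0-commutativeMonoid using (sum-syntax; sum-cong-≗; ∑-distrib-+)

-- Division by ℓ and Hermite's identity

∑[i<n][i<r]≡r : ∀ {n r} → r ≤ n → ∑[ i < n ] (if toℕ i <ᵇ r then 1 else 0) ≡ r
∑[i<n][i<r]≡r {zero}  z≤n       = ≡.refl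
∑[i<n][i<r]≡r {suc n} {zero}  _ = ∑[i<n][i<r]≡r {n} z≤n
∑[i<n][i<r]≡r {suc n} {suc r} (s≤s r≤n) = ≡.cong suc (∑[i<n][i<r]≡r r≤n)

∑[i<n]q≡n*q : ∀ n q → ∑[ i < n ] q ≡ n *ℕ q
∑[i<n]q≡n*q zero    q = ≡.refl
∑[i<n]q≡n*q (suc n) q = ≡.cong (q +ℕ_) (∑[i<n]q≡n*q n q)

module _ (ℓ : ℕ) .{{_ : NonZero ℓ}} where

  open CommutativeSemigroupProperties ℕ.+-commutativeSemigroup using (xy∙z≈xz∙y)

  [k+qℓ+c]/ℓ≡[k+c]/ℓ+q : ∀ k q c → (k +ℕ q *ℕ ℓ +ℕ c) / ℓ ≡ (k +ℕ c) / ℓ +ℕ q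
  [k+qℓ+c]/ℓ≡[k+c]/ℓ+q k q c = begin
    (k +ℕ q *ℕ ℓ +ℕ c) / ℓ      ≡⟨ ≡.cong (_/ ℓ) (xy∙z≈xz∙y k (q *ℕ ℓ) c) ⟩
    (k +ℕ c +ℕ q *ℕ ℓ) / ℓ      ≡⟨ +-distrib-/-∣ʳ (k +ℕ c) (divides-refl q) ⟩
    (k +ℕ c) / ℓ +ℕ q *ℕ ℓ / ℓ  ≡⟨ ≡.cong ((k +ℕ c) / ℓ +ℕ_) (m*n/n≡m q ℓ) ⟩
    (k +ℕ c) / ℓ +ℕ q          ∎
    where open ≡.≡-Reasoning

  [r+ℓ-1-j]/ℓ≡[j<r] : ∀ {r j} → r < ℓ → j < ℓ →
                      (r +ℕ (ℓ ∸ suc j)) / ℓ ≡ (if j <ᵇ r then 1 else 0)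
  [r+ℓ-1-j]/ℓ≡[j<r] {r} {j} r<ℓ j<ℓ with j <ᵇ r | ℕ.<ᵇ-reflects-< j r
  ... | true  | ofʸ j<r =
    ≡.trans (m/n≡1+[m∸n]/n ℓ≤) (≡.cong suc (m<n⇒m/n≡0 (ℕ.m<n+o⇒m∸n<o _ ℓ <2ℓ)))
    where
    ℓ≤ : ℓ ≤ r +ℕ (ℓ ∸ suc j)
    ℓ≤ = ≡.subst (_≤ r +ℕ (ℓ ∸ suc j)) (ℕ.m+[n∸m]≡n j<ℓ) (ℕ.+-monoˡ-≤ (ℓ ∸ suc j) j<r)
    <2ℓ : r +ℕ (ℓ ∸ suc j) < ℓ +ℕ ℓ
    <2ℓ = ℕ.+-mono-<-≤ r<ℓ (ℕ.m∸n≤m ℓ (suc j))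
  ... | false | ofⁿ j≮r = m<n⇒m/n≡0 (≡.subst (r +ℕ (ℓ ∸ suc j) <_) (ℕ.m+[n∸m]≡n j<ℓ)
                            (ℕ.+-monoˡ-< (ℓ ∸ suc j) (s≤s (ℕ.≮⇒≥ j≮r))))

  n%ℓ≡0⇒n≡[n/ℓ]ℓ : ∀ {n} → n % ℓ ≡ 0 → n ≡ n / ℓ *ℕ ℓ
  n%ℓ≡0⇒n≡[n/ℓ]ℓ {n} n%ℓ≡0 = ≡.trans (m≡m%n+[m/n]*n n ℓ) (≡.cong (_+ℕ n / ℓ *ℕ ℓ) n%ℓ≡0)

  [1+n]%ℓ≡1⇒n%ℓ≡0 : ∀ {n} → suc n % ℓ ≡ 1 → n % ℓ ≡ 0
  [1+n]%ℓ≡1⇒n%ℓ≡0 {n} [1+n]%ℓ≡1 = ≡.trans (≡.cong (_% ℓ) n≡) (m*n%n≡0 (suc n / ℓ) ℓ)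
    where
    n≡ : n ≡ suc n / ℓ *ℕ ℓ
    n≡ = ℕ.suc-injective (≡.trans (m≡m%n+[m/n]*n (suc n) ℓ) (≡.cong (_+ℕ suc n / ℓ *ℕ ℓ) [1+n]%ℓ≡1))

  n%ℓ≡0⇒[1+n]%ℓ≡1 : ∀ {n} → 1 < ℓ → n % ℓ ≡ 0 → suc n % ℓ ≡ 1
  n%ℓ≡0⇒[1+n]%ℓ≡1 {n} 1<ℓ n%ℓ≡0 = begin
    suc n % ℓ                  ≡⟨ ≡.cong (λ m → suc m % ℓ) (n%ℓ≡0⇒n≡[n/ℓ]ℓ {n} n%ℓ≡0) ⟩
    (1 +ℕ n / ℓ *ℕ ℓ) % ℓ      ≡⟨ [m+kn]%n≡m%n 1 (n / ℓ) ℓ ⟩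
    1 % ℓ                      ≡⟨ m<n⇒m%n≡m {ℓ} {1} 1<ℓ ⟩
    1                          ∎
    where open ≡.≡-Reasoning

  hermite : ∀ k → ∑[ i < ℓ ] ((k +ℕ (ℓ ∸ suc (toℕ i))) / ℓ) ≡ k
  hermite k = begin
    ∑[ i < ℓ ] ((k +ℕ (ℓ ∸ suc (toℕ i))) / ℓ)        ≡⟨ sum-cong-≗ {ℓ} term ⟩
    ∑[ i < ℓ ] ((if toℕ i <ᵇ r then 1 else 0) +ℕ q)
      ≡⟨ ∑-distrib-+ {ℓ} (λ i → if toℕ i <ᵇ r then 1 else 0) (λ _ → q) ⟩
    ∑[ i < ℓ ] (if toℕ i <ᵇ r then 1 else 0) +ℕ ∑[ i < ℓ ] q
      ≡⟨ ≡.cong₂ _+ℕ_ (∑[i<n][i<r]≡r (ℕ.<⇒≤ (m%n<n k ℓ))) (∑[i<n]q≡n*q ℓ q) ⟩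
    r +ℕ ℓ *ℕ q                                        ≡⟨ ≡.cong (r +ℕ_) (ℕ.*-comm ℓ q) ⟩
    r +ℕ q *ℕ ℓ                                        ≡⟨ m≡m%n+[m/n]*n k ℓ ⟨
    k ∎
    where
    open ≡.≡-Reasoning
    r q : ℕ
    r = k % ℓ
    q = k / ℓ
    term : ∀ i → (k +ℕ (ℓ ∸ suc (toℕ i))) / ℓ ≡ (if toℕ i <ᵇ r then 1 else 0) +ℕ q
    term i = begin
      (k +ℕ (ℓ ∸ suc (toℕ i))) / ℓ
        ≡⟨ ≡.cong (λ m → (m +ℕ (ℓ ∸ suc (toℕ i))) / ℓ) (m≡m%n+[m/n]*n k ℓ) ⟩
      (r +ℕ q *ℕ ℓ +ℕ (ℓ ∸ suc (toℕ i))) / ℓ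
        ≡⟨ [k+qℓ+c]/ℓ≡[k+c]/ℓ+q r q _ ⟩
      (r +ℕ (ℓ ∸ suc (toℕ i))) / ℓ +ℕ q
        ≡⟨ ≡.cong (_+ℕ q) ([r+ℓ-1-j]/ℓ≡[j<r] (m%n<n k ℓ) (Fin.toℕ<n i)) ⟩
      (if toℕ i <ᵇ r then 1 else 0) +ℕ q ∎

module _ {c r} (F : Field c r) where

  open Field F hiding (zero)
  open FieldTheory F

  open CommutativeSemigroupProperties +-commutativeSemigroup using () renaming (interchange to +-interchange)
  open AbelianGroupProperties +-abelianGroup using (xyx⁻¹≈y)

  sumTo-cong : ∀ n {f g : ℕ → Carrier} → (∀ i → i ≤ n → f i ≈ g i) → sumTo n f ≈ sumTo n g
  sumTo-cong zero    f≈g = f≈g 0 z≤n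
  sumTo-cong (suc n) f≈g =
    +-cong (sumTo-cong n (λ i i≤n → f≈g i (ℕ.m≤n⇒m≤1+n i≤n))) (f≈g (suc n) ℕ.≤-refl)

  sumTo-zero : ∀ n {f} → (∀ i → i ≤ n → f i ≈ 0#) → sumTo n f ≈ 0#
  sumTo-zero zero    f≈0 = f≈0 0 z≤n
  sumTo-zero (suc n) f≈0 =
    trans (+-cong (sumTo-zero n (λ i i≤n → f≈0 i (ℕ.m≤n⇒m≤1+n i≤n))) (f≈0 (suc n) ℕ.≤-refl))
          (+-identityˡ 0#)

  sumTo-+ : ∀ n (f g : ℕ → Carrier) → sumTo n (λ i → f i + g i) ≈ sumTo n f + sumTo n g
  sumTo-+ zero    f g = refl
  sumTo-+ (suc n) f g = trans (+-congʳ (sumTo-+ n f g)) (+-interchange _ _ _ _)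

  *-distribˡ-sumTo : ∀ n x (f : ℕ → Carrier) → x * sumTo n f ≈ sumTo n (λ i → x * f i)
  *-distribˡ-sumTo zero    x f = refl
  *-distribˡ-sumTo (suc n) x f = trans (distribˡ x _ _) (+-congʳ (*-distribˡ-sumTo n x f))

  *-distribʳ-sumTo : ∀ n x (f : ℕ → Carrier) → sumTo n f * x ≈ sumTo n (λ i → f i * x)
  *-distribʳ-sumTo zero    x f = refl
  *-distribʳ-sumTo (suc n) x f = trans (distribʳ x _ _) (+-congʳ (*-distribʳ-sumTo n x f))

  sumTo-extend : ∀ {m n} f → m ≤ n → (∀ i → m < i → i ≤ n → f i ≈ 0#) → sumTo n f ≈ sumTo m f
  sumTo-extend {n = zero}  f z≤n _ = refl
  sumTo-extend {n = suc n} f m≤1+n f≈0 with ℕ.m≤n⇒m<n∨m≡n m≤1+n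
  ... | inj₂ ≡.refl    = refl
  ... | inj₁ (s≤s m≤n) = trans
    (+-cong (sumTo-extend f m≤n (λ i m<i i≤n → f≈0 i m<i (ℕ.m≤n⇒m≤1+n i≤n))) (f≈0 (suc n) (s≤s m≤n) ℕ.≤-refl))
    (+-identityʳ _)

  sumTo-last : ∀ m f → (∀ i → i < m → f i ≈ 0#) → sumTo m f ≈ f m
  sumTo-last zero    f _   = refl
  sumTo-last (suc m) f f≈0 = trans (+-congʳ (sumTo-zero m (λ i i≤m → f≈0 i (s≤s i≤m)))) (+-identityˡ _)

  sumTo-single : ∀ {m n} f → m ≤ n → (∀ i → i ≤ n → i ≢ m → f i ≈ 0#) → sumTo n f ≈ f m
  sumTo-single {m} f m≤n f≈0 =
    trans (sumTo-extend f m≤n (λ i m<i i≤n → f≈0 i i≤n (ℕ.>⇒≢ m<i)))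
          (sumTo-last m f (λ i i<m → f≈0 i (ℕ.≤-trans (ℕ.<⇒≤ i<m) m≤n) (ℕ.<⇒≢ i<m)))

  sumTo-comm : ∀ m n (G : ℕ → ℕ → Carrier) →
    sumTo m (λ i → sumTo n (G i)) ≈ sumTo n (λ j → sumTo m (λ i → G i j))
  sumTo-comm zero    n G = refl
  sumTo-comm (suc m) n G = trans (+-congʳ (sumTo-comm m n G)) (sym (sumTo-+ n _ (G (suc m))))

  sumTo-reverse : ∀ n (f : ℕ → Carrier) → sumTo n f ≈ sumTo n (λ i → f (n ∸ i))
  sumTo-reverse zero    f = refl
  sumTo-reverse (suc n) f = trans (+-congʳ (sumTo-reverse n f)) (trans (+-comm _ _) (sym (split-first n)))
    where
    split-first : ∀ m {g : ℕ → Carrier} → sumTo (suc m) g ≈ g 0 + sumTo m (λ i → g (suc i))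
    split-first zero    = refl
    split-first (suc m) = trans (+-congʳ (split-first m)) (+-assoc _ _ _)

  sumTo-triangle : ∀ n (G : ℕ → ℕ → Carrier) →
    sumTo n (λ m → sumTo m (λ q → G q (m ∸ q))) ≈ sumTo n (λ q → sumTo (n ∸ q) (G q))
  sumTo-triangle zero    G = refl
  sumTo-triangle (suc n) G = begin
    sumTo n (λ m → sumTo m (λ q → G q (m ∸ q))) + (sumTo n (λ q → G q (suc n ∸ q)) + G (suc n) (n ∸ n))
      ≈⟨ +-cong (sumTo-triangle n G) (+-congˡ (reflexive (≡.cong (G (suc n)) (ℕ.n∸n≡0 n)))) ⟩
    sumTo n (λ q → sumTo (n ∸ q) (G q)) + (sumTo n (λ q → G q (suc n ∸ q)) + G (suc n) 0)
      ≈⟨ +-assoc _ _ _ ⟨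
    (sumTo n (λ q → sumTo (n ∸ q) (G q)) + sumTo n (λ q → G q (suc n ∸ q))) + G (suc n) 0
      ≈⟨ +-congʳ (sumTo-+ n _ _) ⟨
    sumTo n (λ q → sumTo (n ∸ q) (G q) + G q (suc n ∸ q)) + G (suc n) 0
      ≈⟨ +-cong (sumTo-cong n peel) (reflexive (≡.cong (λ m → sumTo m (G (suc n))) (ℕ.n∸n≡0 n))) ⟨
    sumTo n (λ q → sumTo (suc n ∸ q) (G q)) + sumTo (n ∸ n) (G (suc n)) ∎
    where
    open SetoidReasoning setoid
    peel : ∀ q → q ≤ n → sumTo (suc n ∸ q) (G q) ≈ sumTo (n ∸ q) (G q) + G q (suc n ∸ q)
    peel q q≤n = trans (reflexive (≡.cong (λ m → sumTo m (G q)) (ℕ.+-∸-assoc 1 q≤n)))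
                       (+-congˡ (reflexive (≡.cong (G q) (≡.sym (ℕ.+-∸-assoc 1 q≤n)))))

  ≈S-setoid : Setoid c r
  ≈S-setoid = record
    { Carrier       = Series
    ; _≈_           = _≈S_
    ; isEquivalence = record
      { refl  = λ _ → refl
      ; sym   = λ a≈b n → sym (a≈b n)
      ; trans = λ a≈b b≈c n → trans (a≈b n) (b≈c n)
      }
    }

  module ≈S = Setoid ≈S-setoid

  *S-cong : ∀ {a a' b b'} → a ≈S a' → b ≈S b' → (a *S b) ≈S (a' *S b')
  *S-cong a≈a' b≈b' n = sumTo-cong n (λ i _ → *-cong (a≈a' i) (b≈b' (n ∸ i)))

  *S-comm : ∀ a b → (a *S b) ≈S (b *S a)
  *S-comm a b n = trans (sumTo-reverse n _) (sumTo-cong n (λ i i≤n →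
    trans (*-comm _ _) (*-congʳ (reflexive (≡.cong b (ℕ.m∸[m∸n]≡n i≤n))))))

  *S-assoc : ∀ a b d → ((a *S b) *S d) ≈S (a *S (b *S d))
  *S-assoc a b d n = begin
    sumTo n (λ m → sumTo m (λ q → a q * b (m ∸ q)) * d (n ∸ m))
      ≈⟨ sumTo-cong n (λ m _ → *-distribʳ-sumTo m _ _) ⟩
    sumTo n (λ m → sumTo m (λ q → (a q * b (m ∸ q)) * d (n ∸ m)))
      ≈⟨ sumTo-cong n (λ m _ → sumTo-cong m (λ q q≤m → trans (*-assoc _ _ _)
           (*-congˡ (*-congˡ (reflexive (≡.cong d (≡.sym (n∸q∸[m∸q]≡n∸m n q≤m)))))))) ⟩
    sumTo n (λ m → sumTo m (λ q → a q * (b (m ∸ q) * d (n ∸ q ∸ (m ∸ q)))))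
      ≈⟨ sumTo-triangle n (λ q s → a q * (b s * d (n ∸ q ∸ s))) ⟩
    sumTo n (λ q → sumTo (n ∸ q) (λ s → a q * (b s * d (n ∸ q ∸ s))))
      ≈⟨ sumTo-cong n (λ q _ → *-distribˡ-sumTo (n ∸ q) _ _) ⟨
    sumTo n (λ q → a q * (b *S d) (n ∸ q)) ∎
    where
    open SetoidReasoning setoid
    n∸q∸[m∸q]≡n∸m : ∀ {q m} n → q ≤ m → n ∸ q ∸ (m ∸ q) ≡ n ∸ m
    n∸q∸[m∸q]≡n∸m {q} {m} n q≤m =
      ≡.trans (ℕ.∸-+-assoc n q (m ∸ q)) (≡.cong (n ∸_) (ℕ.m+[n∸m]≡n q≤m))

  tPow : ℕ → Series
  tPow c n = identityM n c

  tPow-diag : ∀ c → tPow c c ≡ 1#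
  tPow-diag zero    = ≡.refl
  tPow-diag (suc c) = tPow-diag c

  tPow-off : ∀ {c n} → n ≢ c → tPow c n ≡ 0#
  tPow-off {zero}  {zero}  n≢c = ⊥-elim (n≢c ≡.refl)
  tPow-off {zero}  {suc n} _   = ≡.refl
  tPow-off {suc c} {zero}  _   = ≡.refl
  tPow-off {suc c} {suc n} n≢c = tPow-off (n≢c ∘ ≡.cong suc)

  oneS≈tPow0 : oneS ≈S tPow 0
  oneS≈tPow0 zero    = refl
  oneS≈tPow0 (suc n) = refl

  tS≈tPow1 : tS ≈S tPow 1
  tS≈tPow1 zero          = refl
  tS≈tPow1 (suc zero)    = refl
  tS≈tPow1 (suc (suc n)) = refl

  tPow-*S-≥ : ∀ {c n} a → c ≤ n → (tPow c *S a) n ≈ a (n ∸ c)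
  tPow-*S-≥ {c} a c≤n = trans
    (sumTo-single _ c≤n (λ i _ i≢c → trans (*-congʳ (reflexive (tPow-off i≢c))) (zeroˡ _)))
    (trans (*-congʳ (reflexive (tPow-diag c))) (*-identityˡ _))

  tPow-*S-< : ∀ {c n} a → n < c → (tPow c *S a) n ≈ 0#
  tPow-*S-< a n<c = sumTo-zero _ (λ i i≤n →
    trans (*-congʳ (reflexive (tPow-off (ℕ.<⇒≢ (ℕ.≤-<-trans i≤n n<c))))) (zeroˡ _))

  *S-identityˡ : ∀ a → (oneS *S a) ≈S a
  *S-identityˡ a n = trans (*S-cong oneS≈tPow0 (≈S.refl {a}) n) (tPow-*S-≥ a z≤n)

  *S-identityʳ : ∀ a → (a *S oneS) ≈S a
  *S-identityʳ a = ≈S.trans (*S-comm a oneS) (*S-identityˡ a)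

  *S-commutativeMonoid : CommutativeMonoid c r
  *S-commutativeMonoid = record
    { Carrier = Series
    ; _≈_     = _≈S_
    ; _∙_     = _*S_
    ; ε       = oneS
    ; isCommutativeMonoid = record
      { isMonoid = record
        { isSemigroup = record
          { isMagma = record { isEquivalence = ≈S.isEquivalence ; ∙-cong = *S-cong }
          ; assoc   = *S-assoc
          }
        ; identity = *S-identityˡ , *S-identityʳ
        }
      ; comm = *S-comm
      }
    }

  tPow-*S-tPow : ∀ c d → (tPow c *S tPow d) ≈S tPow (c +ℕ d)
  tPow-*S-tPow c d n with c ≤? n
  ... | yes c≤n = trans (tPow-*S-≥ (tPow d) c≤n) (reflexive (shift c≤n))
    where
    shift : ∀ {c n} → c ≤ n → tPow d (n ∸ c) ≡ tPow (c +ℕ d) n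
    shift z≤n       = ≡.refl
    shift (s≤s c≤n) = shift c≤n
  ... | no  c≰n = trans (tPow-*S-< (tPow d) (ℕ.≰⇒> c≰n))
                        (sym (reflexive (tPow-off (ℕ.<⇒≢ (ℕ.<-≤-trans (ℕ.≰⇒> c≰n) (ℕ.m≤m+n c d))))))

  tPow-^S : ∀ c q → (tPow c ^S q) ≈S tPow (q *ℕ c)
  tPow-^S c zero    = oneS≈tPow0
  tPow-^S c (suc q) = ≈S.trans (*S-cong ≈S.refl (tPow-^S c q)) (tPow-*S-tPow c (q *ℕ c))


  OrderAtLeast : ℕ → Series → Set r
  OrderAtLeast α a = ∀ n → n < α → a n ≈ 0#

  *S-order : ∀ α β {a b} → OrderAtLeast α a → OrderAtLeast β b → OrderAtLeast (α +ℕ β) (a *S b)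
  *S-order α β {a} {b} ord-a ord-b n n<α+β = sumTo-zero n term
    where
    term : ∀ i → i ≤ n → a i * b (n ∸ i) ≈ 0#
    term i i≤n with i <? α
    ... | yes i<α = trans (*-congʳ (ord-a i i<α)) (zeroˡ _)
    ... | no  i≮α = trans (*-congˡ (ord-b (n ∸ i) n∸i<β)) (zeroʳ _)
      where
      n∸i<β : n ∸ i < β
      n∸i<β = ≡.subst (_≤ β) (ℕ.+-∸-assoc 1 i≤n)
        (ℕ.m≤n+o⇒m∸n≤o (suc n) i (ℕ.≤-trans n<α+β (ℕ.+-monoˡ-≤ β (ℕ.≮⇒≥ i≮α))))

  ^S-order : ∀ α {a} → OrderAtLeast α a → ∀ q → OrderAtLeast (q *ℕ α) (a ^S q)
  ^S-order α ord-a zero    n ()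
  ^S-order α ord-a (suc q) = *S-order α (q *ℕ α) ord-a (^S-order α ord-a q)

  tPow-*S-order : ∀ c a → OrderAtLeast c (tPow c *S a)
  tPow-*S-order c a n = tPow-*S-< a

  tPow-*S-diag : ∀ c a → (tPow c *S a) c ≈ a 0
  tPow-*S-diag c a = trans (tPow-*S-≥ {c} {c} a ℕ.≤-refl) (reflexive (≡.cong a (ℕ.n∸n≡0 c)))

  tS-*S-suc : ∀ X n → (tS *S X) (suc n) ≈ X n
  tS-*S-suc X n = trans (*S-cong {b = X} tS≈tPow1 ≈S.refl (suc n)) (tPow-*S-≥ X (s≤s z≤n))

  tS-*S-order : ∀ X → OrderAtLeast 1 (tS *S X)
  tS-*S-order X zero    _ = zeroˡ (X 0)
  tS-*S-order X (suc n) (s≤s ())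

  open CommutativeSemigroupProperties (CommutativeMonoid.commutativeSemigroup *S-commutativeMonoid)
    using () renaming (interchange to *S-interchange; x∙yz≈y∙xz to *S-leftComm)
  private
    module ∏ = CommutativeMonoidSum *S-commutativeMonoid
    module Pow = CommutativeMonoidMult *S-commutativeMonoid

  ^S≡× : ∀ a k → a ^S k ≡ k Pow.× a
  ^S≡× a zero    = ≡.refl
  ^S≡× a (suc k) = ≡.cong (a *S_) (^S≡× a k)

  prodS≡∏ : ∀ m h → prodS m h ≡ ∏.sum h
  prodS≡∏ zero    h = ≡.refl
  prodS≡∏ (suc m) h = ≡.cong (h fzero *S_) (prodS≡∏ m (h ∘ fsuc))

  ^S-cong : ∀ {a b} q → a ≈S b → (a ^S q) ≈S (b ^S q)
  ^S-cong {a} {b} q a≈b rewrite ^S≡× a q | ^S≡× b q = Pow.×-congʳ q a≈b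

  ^S-+ : ∀ a m n → (a ^S (m +ℕ n)) ≈S ((a ^S m) *S (a ^S n))
  ^S-+ a m n rewrite ^S≡× a (m +ℕ n) | ^S≡× a m | ^S≡× a n = Pow.×-homo-+ a m n

  *S-^S : ∀ a b q → ((a *S b) ^S q) ≈S ((a ^S q) *S (b ^S q))
  *S-^S a b q rewrite ^S≡× (a *S b) q | ^S≡× a q | ^S≡× b q = Pow.×-distrib-+ a b q

  oneS-^S : ∀ q → (oneS ^S q) ≈S oneS
  oneS-^S zero    = ≈S.refl
  oneS-^S (suc q) = ≈S.trans (*S-identityˡ _) (oneS-^S q)

  prodS-cong : ∀ m {x y : Fin m → Series} → (∀ i → x i ≈S y i) → prodS m x ≈S prodS m y
  prodS-cong m {x} {y} x≈y rewrite prodS≡∏ m x | prodS≡∏ m y = ∏.sum-cong-≋ x≈y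

  prodS-* : ∀ m (x y : Fin m → Series) → prodS m (λ i → x i *S y i) ≈S (prodS m x *S prodS m y)
  prodS-* m x y rewrite prodS≡∏ m (λ i → x i *S y i) | prodS≡∏ m x | prodS≡∏ m y = ∏.∑-distrib-+ x y

  prodS-const : ∀ m a → prodS m (λ _ → a) ≈S (a ^S m)
  prodS-const m a rewrite prodS≡∏ m (λ _ → a) | ^S≡× a m = ∏.sum-replicate m

  prodS-^S : ∀ m (x : Fin m → Series) q → prodS m (λ i → x i ^S q) ≈S (prodS m x ^S q)
  prodS-^S m x zero    = ≈S.trans (prodS-const m oneS) (oneS-^S m)
  prodS-^S m x (suc q) = ≈S.trans (prodS-* m x (λ i → x i ^S q)) (*S-cong ≈S.refl (prodS-^S m x q))

  tS-^S : ∀ q → (tS ^S q) ≈S tPow q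
  tS-^S q = ≈S.trans (^S-cong q tS≈tPow1) (≈S.trans (tPow-^S 1 q) (reflexive-tPow (ℕ.*-identityʳ q)))
    where
    reflexive-tPow : ∀ {m n} → m ≡ n → tPow m ≈S tPow n
    reflexive-tPow m≡n k = reflexive (≡.cong (λ m → tPow m k) m≡n)

  prodS-tPow : ∀ m (x : Fin m → ℕ) → prodS m (λ i → tPow (x i)) ≈S tPow (∑[ i < m ] x i)
  prodS-tPow zero    x = oneS≈tPow0
  prodS-tPow (suc m) x = ≈S.trans (*S-cong ≈S.refl (prodS-tPow m (x ∘ fsuc))) (tPow-*S-tPow (x fzero) _)

  *-≉0 : ∀ {x y} → x ≉ 0# → y ≉ 0# → (x * y) ≉ 0#
  *-≉0 {x} {y} x≉0 y≉0 xy≈0 with inverse x x≉0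
  ... | x⁻¹ , xx⁻¹≈1 = y≉0 (begin
    y                ≈⟨ *-identityˡ y ⟨
    1# * y           ≈⟨ *-congʳ (trans (sym xx⁻¹≈1) (*-comm x x⁻¹)) ⟩
    (x⁻¹ * x) * y    ≈⟨ *-assoc x⁻¹ x y ⟩
    x⁻¹ * (x * y)    ≈⟨ *-congˡ xy≈0 ⟩
    x⁻¹ * 0#         ≈⟨ zeroʳ x⁻¹ ⟩
    0#               ∎)
    where open SetoidReasoning setoid

  *S-≉0 : ∀ {a b} → a 0 ≉ 0# → b 0 ≉ 0# → (a *S b) 0 ≉ 0#
  *S-≉0 = *-≉0

  ^S-≉0 : ∀ {a} → a 0 ≉ 0# → ∀ q → (a ^S q) 0 ≉ 0#
  ^S-≉0 a0≉0 zero    = 1≉0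
  ^S-≉0 {a} a0≉0 (suc q) = *S-≉0 {a} {a ^S q} a0≉0 (^S-≉0 a0≉0 q)

  prodS-≉0 : ∀ m {x : Fin m → Series} → (∀ i → x i 0 ≉ 0#) → prodS m x 0 ≉ 0#
  prodS-≉0 zero    _     = 1≉0
  prodS-≉0 (suc m) {x} x0≉0 =
    *S-≉0 {x fzero} {prodS m (x ∘ fsuc)} (x0≉0 fzero) (prodS-≉0 m (x0≉0 ∘ fsuc))

  col : Matrix → ℕ → Series
  col M k n = M n k

  mv : Matrix → Series → Series
  mv M V n = sumTo n (λ m → M n m * V m)

  LowerTriangular : Matrix → Set r
  LowerTriangular M = ∀ n m → n < m → M n m ≈ 0#

  mv-cong : ∀ {A A' V V'} → (∀ n m → m ≤ n → A n m ≈ A' n m) → V ≈S V' → mv A V ≈S mv A' V'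
  mv-cong A≈A' V≈V' n = sumTo-cong n (λ m m≤n → *-cong (A≈A' n m m≤n) (V≈V' m))

  mv-assoc : ∀ A B V → LowerTriangular B → mv A (mv B V) ≈S mv (A ·M B) V
  mv-assoc A B V B-lt n = begin
    sumTo n (λ m → A n m * sumTo m (λ q → B m q * V q))
      ≈⟨ sumTo-cong n (λ m _ → *-distribˡ-sumTo m _ _) ⟩
    sumTo n (λ m → sumTo m (λ q → A n m * (B m q * V q)))
      ≈⟨ sumTo-cong n (λ m m≤n → sumTo-extend _ m≤n (λ q m<q _ →
           trans (*-congˡ (trans (*-congʳ (B-lt m q m<q)) (zeroˡ _))) (zeroʳ _))) ⟨
    sumTo n (λ m → sumTo n (λ q → A n m * (B m q * V q)))
      ≈⟨ sumTo-comm n n _ ⟩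
    sumTo n (λ q → sumTo n (λ m → A n m * (B m q * V q)))
      ≈⟨ sumTo-cong n (λ q _ →
           trans (sumTo-cong n (λ m _ → sym (*-assoc _ _ _))) (sym (*-distribʳ-sumTo n _ _))) ⟩
    sumTo n (λ q → sumTo n (λ m → A n m * B m q) * V q) ∎
    where open SetoidReasoning setoid

  mv-tPow : ∀ A k → LowerTriangular A → mv A (tPow k) ≈S col A k
  mv-tPow A k A-lt n with k ≤? n
  ... | yes k≤n = trans
    (sumTo-single _ k≤n (λ m _ m≢k → trans (*-congˡ (reflexive (tPow-off m≢k))) (zeroʳ _)))
    (trans (*-congˡ (reflexive (tPow-diag k))) (*-identityʳ _))
  ... | no  k≰n = trans
    (sumTo-zero n (λ m m≤n → trans (*-congˡ (reflexive (tPow-off (ℕ.<⇒≢ (ℕ.≤-<-trans m≤n (ℕ.≰⇒> k≰n))))))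
                                   (zeroʳ _)))
    (sym (A-lt n k (ℕ.≰⇒> k≰n)))

  *S-as-mv : ∀ a x → (a *S x) ≈S mv (λ n m → (tPow m *S a) n) x
  *S-as-mv a x n = trans (sumTo-reverse n _) (sumTo-cong n (λ m m≤n →
    *-cong (sym (tPow-*S-≥ a m≤n)) (reflexive (≡.cong x (ℕ.m∸[m∸n]≡n m≤n)))))

  *S-mv : ∀ a M V → LowerTriangular M → (a *S mv M V) ≈S mv (λ n q → (a *S col M q) n) V
  *S-mv a M V M-lt = begin
    a *S mv M V                             ≈⟨ *S-as-mv a (mv M V) ⟩
    mv T (mv M V)                           ≈⟨ mv-assoc T M V M-lt ⟩
    mv (T ·M M) V                           ≈⟨ mv-cong (λ n q _ → sym (*S-as-mv a (col M q) n)) ≈S.refl ⟩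
    mv (λ n q → (a *S col M q) n) V         ∎
    where
    open SetoidReasoning ≈S-setoid
    T : Matrix
    T n m = (tPow m *S a) n

  ·M-cong : ∀ {A A' B B'} → A ≈M A' → B ≈M B' → (A ·M B) ≈M (A' ·M B')
  ·M-cong A≈A' B≈B' n k = sumTo-cong n (λ i _ → *-cong (A≈A' n i) (B≈B' i k))

  ·M-assoc : ∀ A B C → LowerTriangular B → (A ·M (B ·M C)) ≈M ((A ·M B) ·M C)
  ·M-assoc A B C B-lt n k = mv-assoc A B (col C k) B-lt n

  mv-identity : ∀ V → mv identityM V ≈S V
  mv-identity V n = trans (sumTo-single (λ m → identityM n m * V m) ℕ.≤-refl
                             (λ m _ m≢n → trans (*-congʳ (reflexive (tPow-off (m≢n ∘ ≡.sym)))) (zeroˡ _)))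
                          (trans (*-congʳ (reflexive (tPow-diag n))) (*-identityˡ _))

  ·M-identityˡ : ∀ A → (identityM ·M A) ≈M A
  ·M-identityˡ A n k = mv-identity (col A k) n

  ·M-identityʳ : ∀ A → LowerTriangular A → (A ·M identityM) ≈M A
  ·M-identityʳ A A-lt n k = mv-tPow A k A-lt n

  -- A = A (B C) = (A B) C = C, so B A = B C = 1.
  ·M-inverseˡ : ∀ {A B C} → LowerTriangular A → LowerTriangular B →
    (A ·M B) ≈M identityM → (B ·M C) ≈M identityM → (B ·M A) ≈M identityM
  ·M-inverseˡ {A} {B} {C} A-lt B-lt AB≈1 BC≈1 n k = trans (·M-cong {B} (λ _ _ → refl) A≈C n k) (BC≈1 n k)
    where
    A≈C : A ≈M C
    A≈C n k = begin
      A n k                      ≈⟨ ·M-identityʳ A A-lt n k ⟨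
      (A ·M identityM) n k       ≈⟨ ·M-cong {A} (λ _ _ → refl) BC≈1 n k ⟨
      (A ·M (B ·M C)) n k        ≈⟨ ·M-assoc A B C B-lt n k ⟩
      ((A ·M B) ·M C) n k        ≈⟨ ·M-cong {B = C} AB≈1 (λ _ _ → refl) n k ⟩
      (identityM ·M C) n k       ≈⟨ ·M-identityˡ C n k ⟩
      C n k                      ∎
      where open SetoidReasoning setoid

  mv-tPows : ∀ A (σ : ℕ → ℕ) V → LowerTriangular A → (∀ q → q ≤ σ q) →
    mv A (mv (λ n q → tPow (σ q) n) V) ≈S mv (λ n q → A n (σ q)) V
  mv-tPows A σ V A-lt q≤σq =
    ≈S.trans (mv-assoc A _ V tPows-lt) (mv-cong (λ n q _ → mv-tPow A (σ q) A-lt n) ≈S.refl)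
    where
    tPows-lt : LowerTriangular (λ n q → tPow (σ q) n)
    tPows-lt n q n<q = reflexive (tPow-off (ℕ.<⇒≢ (ℕ.<-≤-trans n<q (q≤σq q))))

  module ForwardSubstitution (M : Matrix) (diag≉0 : ∀ n → M n n ≉ 0#) (Y : Series) where

    private
      diag⁻¹ : ℕ → Carrier
      diag⁻¹ n = proj₁ (inverse (M n n) (diag≉0 n))

      diag-cancel : ∀ n z → M n n * (diag⁻¹ n * z) ≈ z
      diag-cancel n z = trans (sym (*-assoc _ _ z))
        (trans (*-congʳ (proj₂ (inverse (M n n) (diag≉0 n)))) (*-identityˡ z))

    -- the coefficient at n forced by the coefficients of V before n
    next : ℕ → Series → Carrier
    next zero    V = diag⁻¹ 0 * Y 0
    next (suc n) V = diag⁻¹ (suc n) * (Y (suc n) - sumTo n (λ m → M (suc n) m * V m))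

    approximant : ℕ → Series
    approximant zero    _ = 0#
    approximant (suc n) m = if m <ᵇ n then approximant n m else next n (approximant n)

    solution : Series
    solution n = next n (approximant n)

    approximant-stable : ∀ {m n} → m < n → approximant n m ≡ solution m
    approximant-stable {m} {suc n} m<1+n with m <ᵇ n | ℕ.<ᵇ-reflects-< m n
    ... | true  | ofʸ m<n = approximant-stable m<n
    ... | false | ofⁿ m≮n = ≡.cong solution (ℕ.≤-antisym (ℕ.≮⇒≥ m≮n) (ℕ.≤-pred m<1+n))

    solves : mv M solution ≈S Y
    solves zero    = diag-cancel 0 (Y 0)
    solves (suc n) = begin
      s + M (suc n) (suc n) * solution (suc n)
        ≈⟨ +-congˡ (*-congˡ (*-congˡ (+-congˡ (-‿cong (sumTo-cong n (λ m m≤n →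
             *-congˡ (reflexive (approximant-stable (s≤s m≤n))))))))) ⟩
      s + M (suc n) (suc n) * (diag⁻¹ (suc n) * (Y (suc n) - s))
        ≈⟨ +-congˡ (diag-cancel (suc n) _) ⟩
      s + (Y (suc n) - s)
        ≈⟨ +-assoc s (Y (suc n)) (- s) ⟨
      s + Y (suc n) - s
        ≈⟨ xyx⁻¹≈y s (Y (suc n)) ⟩
      Y (suc n) ∎
      where
      open SetoidReasoning setoid
      s : Carrier
      s = sumTo n (λ m → M (suc n) m * solution m)

    solution-≉0 : Y 0 ≉ 0# → solution 0 ≉ 0#
    solution-≉0 Y0≉0 sol0≈0 = Y0≉0 (trans (sym (solves 0)) (trans (*-congˡ sol0≈0) (zeroʳ _)))

  -- Composition

  powers : Series → Matrix
  powers P n q = (P ^S q) n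

  _∘S_ : Series → Series → Series
  U ∘S P = mv (powers P) U

  powers-lowerTriangular : ∀ {P} → OrderAtLeast 1 P → LowerTriangular (powers P)
  powers-lowerTriangular {P} P-ord n q n<q =
    ^S-order 1 P-ord q n (≡.subst (n <_) (≡.sym (ℕ.*-identityʳ q)) n<q)

  ∘S-cong : ∀ {U U' P P'} → U ≈S U' → P ≈S P' → (U ∘S P) ≈S (U' ∘S P')
  ∘S-cong U≈U' P≈P' = mv-cong (λ n q _ → ^S-cong q P≈P' n) U≈U'

  ∘S-≉0 : ∀ {U} P → U 0 ≉ 0# → (U ∘S P) 0 ≉ 0#
  ∘S-≉0 P U0≉0 U∘P0≈0 = U0≉0 (trans (sym (*-identityˡ _)) U∘P0≈0)

  tPow-∘S : ∀ q {P} → OrderAtLeast 1 P → (tPow q ∘S P) ≈S (P ^S q)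
  tPow-∘S q {P} P-ord = mv-tPow (powers P) q (powers-lowerTriangular P-ord)

  oneS-∘S : ∀ {P} → OrderAtLeast 1 P → (oneS ∘S P) ≈S oneS
  oneS-∘S P-ord = ≈S.trans (∘S-cong oneS≈tPow0 ≈S.refl) (tPow-∘S 0 P-ord)

  tPow-*S-∘S : ∀ m U {P} → OrderAtLeast 1 P → ((tPow m *S U) ∘S P) ≈S ((P ^S m) *S (U ∘S P))
  tPow-*S-∘S m U {P} P-ord = begin
    (tPow m *S U) ∘S P
      ≈⟨ ∘S-cong (*S-as-mv (tPow m) U) ≈S.refl ⟩
    mv (powers P) (mv (λ n q → (tPow q *S tPow m) n) U)
      ≈⟨ mv-cong (λ _ _ _ → refl) (mv-cong (λ n q _ → tPow-*S-tPow q m n) ≈S.refl) ⟩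
    mv (powers P) (mv (λ n q → tPow (q +ℕ m) n) U)
      ≈⟨ mv-tPows (powers P) (_+ℕ m) U P-lt (λ q → ℕ.m≤m+n q m) ⟩
    mv (λ n q → (P ^S (q +ℕ m)) n) U
      ≈⟨ mv-cong (λ n q _ → trans (^S-+ P q m n) (*S-comm _ _ n)) ≈S.refl ⟩
    mv (λ n q → ((P ^S m) *S (P ^S q)) n) U
      ≈⟨ *S-mv (P ^S m) (powers P) U P-lt ⟨
    (P ^S m) *S (U ∘S P) ∎
    where
    open SetoidReasoning ≈S-setoid
    P-lt : LowerTriangular (powers P)
    P-lt = powers-lowerTriangular P-ord

  *S-∘S : ∀ U V {P} → OrderAtLeast 1 P → ((U *S V) ∘S P) ≈S ((U ∘S P) *S (V ∘S P))
  *S-∘S U V {P} P-ord = begin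
    (U *S V) ∘S P
      ≈⟨ ∘S-cong (*S-as-mv U V) ≈S.refl ⟩
    mv (powers P) (mv (λ n m → (tPow m *S U) n) V)
      ≈⟨ mv-assoc (powers P) _ V (λ n m → tPow-*S-order m U n) ⟩
    mv (λ n m → ((tPow m *S U) ∘S P) n) V
      ≈⟨ mv-cong (λ n m _ → trans (tPow-*S-∘S m U P-ord n) (*S-comm _ _ n)) ≈S.refl ⟩
    mv (λ n m → ((U ∘S P) *S (P ^S m)) n) V
      ≈⟨ *S-mv (U ∘S P) (powers P) V (powers-lowerTriangular P-ord) ⟨
    (U ∘S P) *S (V ∘S P) ∎
    where open SetoidReasoning ≈S-setoid

  ^S-∘S : ∀ U q {P} → OrderAtLeast 1 P → ((U ^S q) ∘S P) ≈S ((U ∘S P) ^S q)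
  ^S-∘S U zero    P-ord = oneS-∘S P-ord
  ^S-∘S U (suc q) P-ord = ≈S.trans (*S-∘S U (U ^S q) P-ord) (*S-cong ≈S.refl (^S-∘S U q P-ord))

  prodS-∘S : ∀ m (X : Fin m → Series) {P} → OrderAtLeast 1 P →
    (prodS m X ∘S P) ≈S prodS m (λ i → X i ∘S P)
  prodS-∘S zero    X P-ord = oneS-∘S P-ord
  prodS-∘S (suc m) X P-ord =
    ≈S.trans (*S-∘S (X fzero) (prodS m (X ∘ fsuc)) P-ord) (*S-cong ≈S.refl (prodS-∘S m (X ∘ fsuc) P-ord))

  ∘S-assoc : ∀ V {R S} → OrderAtLeast 1 R → OrderAtLeast 1 S → ((V ∘S R) ∘S S) ≈S (V ∘S (R ∘S S))
  ∘S-assoc V {R} {S} R-ord S-ord =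
    ≈S.trans (mv-assoc (powers S) (powers R) V (powers-lowerTriangular R-ord))
             (mv-cong (λ n q _ → ^S-∘S R q S-ord n) ≈S.refl)

  ∘S-solve : ∀ {h Q} → h 0 ≉ 0# → Q 0 ≉ 0# →
    Σ Series (λ V → (h *S (V ∘S (tS *S Q))) ≈S oneS × V 0 ≉ 0#)
  ∘S-solve {h} {Q} h0≉0 Q0≉0 =
      solution
    , ≈S.trans (*S-mv h (powers R) solution (powers-lowerTriangular (tS-*S-order Q))) solves
    , solution-≉0 1≉0
    where
    R : Series
    R = tS *S Q
    M : Matrix
    M n q = (h *S (R ^S q)) n
    diag≉0 : ∀ q → M q q ≉ 0#
    diag≉0 q Mqq≈0 = *S-≉0 {h} {Q ^S q} h0≉0 (^S-≉0 Q0≉0 q) (begin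
      (h *S (Q ^S q)) 0                    ≈⟨ tPow-*S-diag q (h *S (Q ^S q)) ⟨
      (tPow q *S (h *S (Q ^S q))) q        ≈⟨ *S-leftComm h (tPow q) (Q ^S q) q ⟨
      (h *S (tPow q *S (Q ^S q))) q
        ≈⟨ *S-cong ≈S.refl (≈S.trans (*S-^S tS Q q) (*S-cong {b = Q ^S q} (tS-^S q) ≈S.refl)) q ⟨
      (h *S (R ^S q)) q                    ≈⟨ Mqq≈0 ⟩
      0#                                   ∎)
      where open SetoidReasoning setoid
    open ForwardSubstitution M diag≉0 oneS

  powerProduct : ∀ {m} → Series → (Fin m → Series) → (Fin m → ℕ) → Series
  powerProduct {m} γ φ x = γ *S prodS m (λ i → φ i ^S x i)

  module _ {m : ℕ} where

    powerProduct-cong : ∀ {γ γ' φ φ'} x → γ ≈S γ' → (∀ i → φ i ≈S φ' i) →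
      powerProduct γ φ x ≈S powerProduct γ' φ' x
    powerProduct-cong x γ≈γ' φ≈φ' = *S-cong γ≈γ' (prodS-cong m (λ i → ^S-cong (x i) (φ≈φ' i)))

    powerProduct-congˣ : ∀ γ φ {x y} → (∀ i → x i ≡ y i) → powerProduct γ φ x ≈S powerProduct γ φ y
    powerProduct-congˣ γ φ x≡y =
      *S-cong ≈S.refl (prodS-cong m (λ i n → reflexive (≡.cong (λ k → (φ i ^S k) n) (x≡y i))))

    powerProduct-+ : ∀ γ φ x q →
      powerProduct γ φ (λ i → x i +ℕ q) ≈S (powerProduct γ φ x *S (prodS m φ ^S q))
    powerProduct-+ γ φ x q = begin
      γ *S prodS m (λ i → φ i ^S (x i +ℕ q))
        ≈⟨ *S-cong ≈S.refl (prodS-cong m (λ i → ^S-+ (φ i) (x i) q)) ⟩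
      γ *S prodS m (λ i → (φ i ^S x i) *S (φ i ^S q))
        ≈⟨ *S-cong ≈S.refl (prodS-* m _ _) ⟩
      γ *S (prodS m (λ i → φ i ^S x i) *S prodS m (λ i → φ i ^S q))
        ≈⟨ *S-cong ≈S.refl (*S-cong ≈S.refl (prodS-^S m φ q)) ⟩
      γ *S (prodS m (λ i → φ i ^S x i) *S (prodS m φ ^S q))
        ≈⟨ *S-assoc γ (prodS m (λ i → φ i ^S x i)) (prodS m φ ^S q) ⟨
      powerProduct γ φ x *S (prodS m φ ^S q) ∎
      where open SetoidReasoning ≈S-setoid

    powerProduct-*S : ∀ γ γ' φ φ' x →
      (powerProduct γ φ x *S powerProduct γ' φ' x) ≈S powerProduct (γ *S γ') (λ i → φ i *S φ' i) x
    powerProduct-*S γ γ' φ φ' x = ≈S.trans (*S-interchange γ Π γ' Π')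
      (*S-cong ≈S.refl (≈S.sym (≈S.trans (prodS-cong m (λ i → *S-^S (φ i) (φ' i) (x i)))
                                          (prodS-* m (λ i → φ i ^S x i) (λ i → φ' i ^S x i)))))
      where
      Π Π' : Series
      Π  = prodS m (λ i → φ i ^S x i)
      Π' = prodS m (λ i → φ' i ^S x i)

    powerProduct-∘S : ∀ γ φ x {R} → OrderAtLeast 1 R →
      (powerProduct γ φ x ∘S R) ≈S powerProduct (γ ∘S R) (λ i → φ i ∘S R) x
    powerProduct-∘S γ φ x R-ord = ≈S.trans (*S-∘S γ _ R-ord) (*S-cong ≈S.refl (≈S.trans
      (prodS-∘S m _ R-ord) (prodS-cong m (λ i → ^S-∘S (φ i) (x i) R-ord))))

    powerProduct-*S-∘S : ∀ γ φ γ' φ' x {R} → OrderAtLeast 1 R →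
      (powerProduct γ φ x *S (powerProduct γ' φ' x ∘S R))
        ≈S powerProduct (γ *S (γ' ∘S R)) (λ i → φ i *S (φ' i ∘S R)) x
    powerProduct-*S-∘S γ φ γ' φ' x {R} R-ord = ≈S.trans (*S-cong ≈S.refl (powerProduct-∘S γ' φ' x R-ord))
                                                        (powerProduct-*S γ (γ' ∘S R) φ (λ i → φ' i ∘S R) x)

    powerProduct-oneS : ∀ x → powerProduct oneS (λ _ → oneS) x ≈S oneS
    powerProduct-oneS x = ≈S.trans (*S-identityˡ _) (≈S.trans (prodS-cong m (λ i → oneS-^S (x i)))
      (≈S.trans (prodS-const m oneS) (oneS-^S m)))

    powerProduct-≉0 : ∀ {γ φ} x → γ 0 ≉ 0# → (∀ i → φ i 0 ≉ 0#) → powerProduct γ φ x 0 ≉ 0#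
    powerProduct-≉0 {γ} {φ} x γ0≉0 φ0≉0 = *S-≉0 {γ} {prodS m (λ i → φ i ^S x i)} γ0≉0
      (prodS-≉0 m (λ i → ^S-≉0 (φ0≉0 i) (x i)))

  powerProduct-tS : ∀ {m} (x : Fin m → ℕ) → powerProduct tS (λ _ → tS) x ≈S tPow (suc (∑[ i < m ] x i))
  powerProduct-tS {m} x =
    ≈S.trans (*S-cong tS≈tPow1 (≈S.trans (prodS-cong m (λ i → tS-^S (x i))) (prodS-tPow m x)))
             (tPow-*S-tPow 1 (∑[ i < m ] x i))

  -- Substitution t ↦ t^ℓ

  module _ (ℓ : ℕ) .{{_ : NonZero ℓ}} where

    inflate : Series → Series
    inflate U = U ∘S tPow ℓ

    deflate : Series → Series
    deflate a n = a (n *ℕ ℓ)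

    tPow-ℓ-order : OrderAtLeast 1 (tPow ℓ)
    tPow-ℓ-order zero _ = reflexive (tPow-off (≢-nonZero⁻¹ ℓ ∘ ≡.sym))
    tPow-ℓ-order (suc n) (s≤s ())

    inflate-cong : ∀ {U V} → U ≈S V → inflate U ≈S inflate V
    inflate-cong U≈V = ∘S-cong U≈V ≈S.refl

    inflate-*S : ∀ U V → inflate (U *S V) ≈S (inflate U *S inflate V)
    inflate-*S U V = *S-∘S U V tPow-ℓ-order

    inflate-oneS : inflate oneS ≈S oneS
    inflate-oneS = oneS-∘S tPow-ℓ-order

    inflate-tPow : ∀ q → inflate (tPow q) ≈S tPow (q *ℕ ℓ)
    inflate-tPow q = ≈S.trans (tPow-∘S q tPow-ℓ-order) (tPow-^S ℓ q)

    inflate-≉0 : ∀ {U} → U 0 ≉ 0# → inflate U 0 ≉ 0#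
    inflate-≉0 {U} = ∘S-≉0 {U} (tPow ℓ)

    ∘S-inflate : ∀ V {R} → OrderAtLeast 1 R → (V ∘S inflate R) ≈S inflate (V ∘S R)
    ∘S-inflate V R-ord = ≈S.sym (∘S-assoc V R-ord tPow-ℓ-order)

    inflate-mv : ∀ C V → LowerTriangular C → mv (λ n q → inflate (col C q) n) V ≈S inflate (mv C V)
    inflate-mv C V C-lt = ≈S.sym (mv-assoc (powers (tPow ℓ)) C V C-lt)

    tPow-*S-inflate : ∀ c V → (tPow c *S inflate V) ≈S mv (λ n q → tPow (c +ℕ q *ℕ ℓ) n) V
    tPow-*S-inflate c V = ≈S.trans (*S-mv (tPow c) (powers (tPow ℓ)) V (powers-lowerTriangular tPow-ℓ-order))
      (mv-cong (λ n q _ → trans (*S-cong ≈S.refl (tPow-^S ℓ q) n) (tPow-*S-tPow c (q *ℕ ℓ) n)) ≈S.refl)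

    inflate-at : ∀ U n → inflate U (n *ℕ ℓ) ≈ U n
    inflate-at U n = trans
      (sumTo-single _ (ℕ.m≤m*n n ℓ) (λ q _ q≢n →
        trans (*-congʳ (power≈0 {q} (q≢n ∘ ℕ.*-cancelʳ-≡ q n ℓ ∘ ≡.sym))) (zeroˡ _)))
      (trans (*-congʳ (trans (tPow-^S ℓ n (n *ℕ ℓ)) (reflexive (tPow-diag (n *ℕ ℓ))))) (*-identityˡ _))
      where
      power≈0 : ∀ {q} → n *ℕ ℓ ≢ q *ℕ ℓ → (tPow ℓ ^S q) (n *ℕ ℓ) ≈ 0#
      power≈0 {q} ne = trans (tPow-^S ℓ q (n *ℕ ℓ)) (reflexive (tPow-off ne))

    inflate-off : ∀ U {n} → (∀ q → n ≢ q *ℕ ℓ) → inflate U n ≈ 0#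
    inflate-off U {n} n≢qℓ = sumTo-zero n (λ q _ →
      trans (*-congʳ (trans (tPow-^S ℓ q n) (reflexive (tPow-off (n≢qℓ q))))) (zeroˡ _))

    inflate-tS : inflate tS ≈S tPow ℓ
    inflate-tS = ≈S.trans (inflate-cong tS≈tPow1)
      (≈S.trans (inflate-tPow 1) (λ n → reflexive (≡.cong (λ m → tPow m n) (ℕ.*-identityˡ ℓ))))

    inflate-as-mv : ∀ V → inflate V ≈S mv (λ n q → tPow (q *ℕ ℓ) n) V
    inflate-as-mv V = mv-cong (λ n q _ → tPow-^S ℓ q n) ≈S.refl

    powerProduct-inflate : ∀ {m} γ φ (x : Fin m → ℕ) →
      powerProduct (tS *S inflate γ) (λ i → tS *S inflate (φ i)) x
        ≈S (tPow (suc (∑[ i < m ] x i)) *S inflate (powerProduct γ φ x))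
    powerProduct-inflate γ φ x = ≈S.trans (≈S.sym (powerProduct-*S tS (inflate γ) (λ _ → tS) (inflate ∘ φ) x))
      (*S-cong (powerProduct-tS x) (≈S.sym (powerProduct-∘S γ φ x tPow-ℓ-order)))

  module _ (p : ℕ) where

    ℓ : ℕ
    ℓ = suc (suc p)

    -- e k i is the exponent of f_{i+1} in column k + 1
    e : ℕ → Fin ℓ → ℕ
    e k i = expo ℓ i (suc k)

    ∑e≡k : ∀ k → ∑[ i < ℓ ] e k i ≡ k
    ∑e≡k = hermite ℓ

    e-+ : ∀ k q i → e (k +ℕ q *ℕ ℓ) i ≡ e k i +ℕ q
    e-+ k q i = [k+qℓ+c]/ℓ≡[k+c]/ℓ+q ℓ k q (ℓ ∸ suc (toℕ i))

    InPowersOf-cong : ∀ {a a'} → a ≈S a' → InPowersOf ℓ a → InPowersOf ℓ a'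
    InPowersOf-cong a≈a' a-ser n n%ℓ≢0 = trans (sym (a≈a' n)) (a-ser n n%ℓ≢0)

    inflate-InPowersOf : ∀ U → InPowersOf ℓ (inflate ℓ U)
    inflate-InPowersOf U n n%ℓ≢0 =
      inflate-off ℓ U {n} (λ q n≡qℓ → n%ℓ≢0 (≡.trans (≡.cong (_% ℓ) n≡qℓ) (m*n%n≡0 q ℓ)))

    InPowersOf⇒≈inflate : ∀ {a} → InPowersOf ℓ a → a ≈S inflate ℓ (deflate ℓ a)
    InPowersOf⇒≈inflate {a} a-ser n with n % ℓ ℕ.≟ 0
    ... | no  n%ℓ≢0 = trans (a-ser n n%ℓ≢0) (sym (inflate-InPowersOf (deflate ℓ a) n n%ℓ≢0))
    ... | yes n%ℓ≡0 = ≡.subst (λ m → a m ≈ inflate ℓ (deflate ℓ a) m)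
                              (≡.sym (n%ℓ≡0⇒n≡[n/ℓ]ℓ ℓ {n} n%ℓ≡0))
                              (sym (inflate-at ℓ (deflate ℓ a) (n / ℓ)))

    tS*inflate-InTTimesPowersOf : ∀ U → InTTimesPowersOf ℓ (tS *S inflate ℓ U)
    tS*inflate-InTTimesPowersOf U zero    _           = zeroˡ _
    tS*inflate-InTTimesPowersOf U (suc n) [1+n]%ℓ≢1 =
      trans (tS-*S-suc (inflate ℓ U) n)
            (inflate-InPowersOf U n ([1+n]%ℓ≢1 ∘ n%ℓ≡0⇒[1+n]%ℓ≡1 ℓ {n} (s≤s (s≤s z≤n))))

    InTTimesPowersOf⇒≈tS*inflate : ∀ {f} → InTTimesPowersOf ℓ f →
      f ≈S (tS *S inflate ℓ (deflate ℓ (f ∘ suc)))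
    InTTimesPowersOf⇒≈tS*inflate {f} f-ser zero    = trans (f-ser 0 (λ ())) (sym (zeroˡ _))
    InTTimesPowersOf⇒≈tS*inflate {f} f-ser (suc n) =
      trans (InPowersOf⇒≈inflate (λ m m%ℓ≢0 → f-ser (suc m) (m%ℓ≢0 ∘ [1+n]%ℓ≡1⇒n%ℓ≡0 ℓ {m})) n)
            (sym (tS-*S-suc (inflate ℓ (deflate ℓ (f ∘ suc))) n))

    module Hats (d : MaRData ℓ) where
      open MaRData d

      b̂ ĝ : Series
      b̂ = deflate ℓ b
      ĝ = deflate ℓ g

      f̂ : Fin ℓ → Series
      f̂ i = deflate ℓ (fs i ∘ suc)

      R : Series
      R = tS *S prodS ℓ f̂

      Û : ℕ → Series
      Û k = powerProduct ĝ f̂ (e k)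

      R-order : OrderAtLeast 1 R
      R-order = tS-*S-order (prodS ℓ f̂)

      b≈ : b ≈S inflate ℓ b̂
      b≈ = InPowersOf⇒≈inflate b-ser

      g≈ : g ≈S inflate ℓ ĝ
      g≈ = InPowersOf⇒≈inflate g-ser

      f≈ : ∀ i → fs i ≈S (tS *S inflate ℓ (f̂ i))
      f≈ i = InTTimesPowersOf⇒≈tS*inflate (fs-ser i)

      f≈t⇒f̂≈1 : ∀ {i} → fs i ≈S tS → f̂ i ≈S oneS
      f≈t⇒f̂≈1 f≈t zero    = f≈t 1
      f≈t⇒f̂≈1 f≈t (suc n) = f≈t (suc (suc n *ℕ ℓ))

      P : Series
      P = prodS ℓ fs

      P-order : OrderAtLeast 1 P
      P-order zero    _ = trans (*-congʳ (fs-ser fzero 0 (λ ()))) (zeroˡ _)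
      P-order (suc n) (s≤s ())

      P≈inflateR : P ≈S inflate ℓ R
      P≈inflateR = begin
        prodS ℓ fs
          ≈⟨ prodS-cong ℓ f≈ ⟩
        prodS ℓ (λ i → tS *S inflate ℓ (f̂ i))
          ≈⟨ prodS-* ℓ (λ _ → tS) (λ i → inflate ℓ (f̂ i)) ⟩
        prodS ℓ (λ _ → tS) *S prodS ℓ (λ i → inflate ℓ (f̂ i))
          ≈⟨ *S-cong (prodS-const ℓ tS) (≈S.sym (prodS-∘S ℓ f̂ (tPow-ℓ-order ℓ))) ⟩
        (tS ^S ℓ) *S inflate ℓ (prodS ℓ f̂)
          ≈⟨ *S-cong {b = inflate ℓ (prodS ℓ f̂)} (≈S.trans (tS-^S ℓ) (≈S.sym (inflate-tS ℓ))) ≈S.refl ⟩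
        inflate ℓ tS *S inflate ℓ (prodS ℓ f̂)
          ≈⟨ inflate-*S ℓ tS (prodS ℓ f̂) ⟨
        inflate ℓ R ∎
        where open SetoidReasoning ≈S-setoid

      column-inflate : ∀ k → column d (suc k) ≈S (tPow (suc k) *S inflate ℓ (Û k))
      column-inflate k = begin
        powerProduct (tS *S g) fs (e k)
          ≈⟨ powerProduct-cong (e k) (*S-cong ≈S.refl g≈) f≈ ⟩
        powerProduct (tS *S inflate ℓ ĝ) (λ i → tS *S inflate ℓ (f̂ i)) (e k)
          ≈⟨ powerProduct-inflate ℓ ĝ f̂ (e k) ⟩
        tPow (suc (∑[ i < ℓ ] e k i)) *S inflate ℓ (Û k)
          ≡⟨ ≡.cong (λ m → tPow (suc m) *S inflate ℓ (Û k)) (∑e≡k k) ⟩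
        tPow (suc k) *S inflate ℓ (Û k) ∎
        where open SetoidReasoning ≈S-setoid

      column-+ : ∀ k q → column d (suc k +ℕ q *ℕ ℓ) ≈S (column d (suc k) *S (P ^S q))
      column-+ k q =
        ≈S.trans (powerProduct-congˣ (tS *S g) fs (e-+ k q)) (powerProduct-+ (tS *S g) fs (e k) q)

      array-lowerTriangular : LowerTriangular (array d)
      array-lowerTriangular n zero    ()
      array-lowerTriangular n (suc k) n<1+k =
        trans (column-inflate k n) (tPow-*S-order (suc k) (inflate ℓ (Û k)) n n<1+k)

      array-diag≉0 : ∀ n → array d n n ≉ 0#
      array-diag≉0 zero    = b0≉0
      array-diag≉0 (suc k) column≈0 =
        inflate-≉0 ℓ {Û k} (powerProduct-≉0 {γ = ĝ} {f̂} (e k) g0≉0 fs1≉0)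
          (trans (sym (tPow-*S-diag (suc k) (inflate ℓ (Û k)))) (trans (sym (column-inflate k (suc k))) column≈0))

      array-action : ∀ k V →
        mv (array d) (tPow (suc k) *S inflate ℓ V) ≈S (tPow (suc k) *S inflate ℓ (Û k *S (V ∘S R)))
      array-action k V = begin
        mv (array d) (tPow (suc k) *S inflate ℓ V)
          ≈⟨ mv-cong (λ _ _ _ → refl) (tPow-*S-inflate ℓ (suc k) V) ⟩
        mv (array d) (mv (λ n q → tPow (suc k +ℕ q *ℕ ℓ) n) V)
          ≈⟨ mv-tPows (array d) (λ q → suc k +ℕ q *ℕ ℓ) V array-lowerTriangular
               (λ q → ℕ.≤-trans (ℕ.m≤m*n q ℓ) (ℕ.m≤n+m (q *ℕ ℓ) (suc k))) ⟩
        mv (λ n q → column d (suc k +ℕ q *ℕ ℓ) n) V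
          ≈⟨ mv-cong (λ n q _ → column-+ k q n) ≈S.refl ⟩
        mv (λ n q → (column d (suc k) *S (P ^S q)) n) V
          ≈⟨ *S-mv (column d (suc k)) (powers P) V (powers-lowerTriangular P-order) ⟨
        column d (suc k) *S (V ∘S P)
          ≈⟨ *S-cong (column-inflate k) (≈S.trans (∘S-cong ≈S.refl P≈inflateR) (∘S-inflate ℓ V R-order)) ⟩
        (tPow (suc k) *S inflate ℓ (Û k)) *S inflate ℓ (V ∘S R)
          ≈⟨ *S-assoc (tPow (suc k)) (inflate ℓ (Û k)) (inflate ℓ (V ∘S R)) ⟩
        tPow (suc k) *S (inflate ℓ (Û k) *S inflate ℓ (V ∘S R))
          ≈⟨ *S-cong ≈S.refl (inflate-*S ℓ (Û k) (V ∘S R)) ⟨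
        tPow (suc k) *S inflate ℓ (Û k *S (V ∘S R)) ∎
        where open SetoidReasoning ≈S-setoid

      Ĉ : Matrix
      Ĉ n q = column d (q *ℕ ℓ) (n *ℕ ℓ)

      Ĉ-lowerTriangular : LowerTriangular Ĉ
      Ĉ-lowerTriangular n q n<q = array-lowerTriangular (n *ℕ ℓ) (q *ℕ ℓ) (ℕ.*-monoˡ-< ℓ n<q)

      Ĉ-diag≉0 : ∀ n → Ĉ n n ≉ 0#
      Ĉ-diag≉0 n = array-diag≉0 (n *ℕ ℓ)

      column-qℓ-InPowersOf : ∀ q → InPowersOf ℓ (column d (q *ℕ ℓ))
      column-qℓ-InPowersOf zero    = b-ser
      column-qℓ-InPowersOf (suc q) = InPowersOf-cong (≈S.sym column≈) (inflate-InPowersOf _)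
        where
        W : Series
        W = Û (suc p +ℕ q *ℕ ℓ)
        column≈ : column d (suc q *ℕ ℓ) ≈S inflate ℓ (tPow (suc q) *S W)
        column≈ = ≈S.trans (column-inflate (suc p +ℕ q *ℕ ℓ))
          (≈S.trans (*S-cong {b = inflate ℓ W} (≈S.sym (inflate-tPow ℓ (suc q))) ≈S.refl)
                    (≈S.sym (inflate-*S ℓ (tPow (suc q)) W)))

      array-inflate : ∀ V → mv (array d) (inflate ℓ V) ≈S inflate ℓ (mv Ĉ V)
      array-inflate V = begin
        mv (array d) (inflate ℓ V)
          ≈⟨ mv-cong (λ _ _ _ → refl) (inflate-as-mv ℓ V) ⟩
        mv (array d) (mv (λ n q → tPow (q *ℕ ℓ) n) V)
          ≈⟨ mv-tPows (array d) (_*ℕ ℓ) V array-lowerTriangular (λ q → ℕ.m≤m*n q ℓ) ⟩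
        mv (λ n q → column d (q *ℕ ℓ) n) V
          ≈⟨ mv-cong (λ n q _ → InPowersOf⇒≈inflate (column-qℓ-InPowersOf q) n) ≈S.refl ⟩
        mv (λ n q → inflate ℓ (col Ĉ q) n) V
          ≈⟨ inflate-mv ℓ Ĉ V Ĉ-lowerTriangular ⟩
        inflate ℓ (mv Ĉ V) ∎
        where open SetoidReasoning ≈S-setoid

    fromHats : (β γ : Series) (φ : Fin ℓ → Series) →
      β 0 ≉ 0# → γ 0 ≉ 0# → (∀ i → φ i 0 ≉ 0#) → MaRData ℓ
    fromHats β γ φ β0≉0 γ0≉0 φ0≉0 = record
      { b      = inflate ℓ β
      ; g      = inflate ℓ γ
      ; fs     = λ i → tS *S inflate ℓ (φ i)
      ; b-ser  = inflate-InPowersOf β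
      ; g-ser  = inflate-InPowersOf γ
      ; fs-ser = λ i → tS*inflate-InTTimesPowersOf (φ i)
      ; b0≉0   = inflate-≉0 ℓ {β} β0≉0
      ; g0≉0   = inflate-≉0 ℓ {γ} γ0≉0
      ; fs1≉0  = λ i f1≈0 →
          inflate-≉0 ℓ {φ i} (φ0≉0 i) (trans (sym (tS-*S-suc (inflate ℓ (φ i)) 0)) f1≈0)
      }

    module FromHats (β γ : Series) (φ : Fin ℓ → Series)
                    (β0≉0 : β 0 ≉ 0#) (γ0≉0 : γ 0 ≉ 0#) (φ0≉0 : ∀ i → φ i 0 ≉ 0#) where

      d : MaRData ℓ
      d = fromHats β γ φ β0≉0 γ0≉0 φ0≉0

      open Hats d

      b̂≈β : b̂ ≈S β
      b̂≈β = inflate-at ℓ β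

      ĝ≈γ : ĝ ≈S γ
      ĝ≈γ = inflate-at ℓ γ

      f̂≈φ : ∀ i → f̂ i ≈S φ i
      f̂≈φ i n = trans (tS-*S-suc (inflate ℓ (φ i)) (n *ℕ ℓ)) (inflate-at ℓ (φ i) n)

      column≈ : ∀ k → column d (suc k) ≈S (tPow (suc k) *S inflate ℓ (powerProduct γ φ (e k)))
      column≈ k = ≈S.trans (column-inflate k)
        (*S-cong ≈S.refl (inflate-cong ℓ (powerProduct-cong (e k) ĝ≈γ f̂≈φ)))

      fs≈tS : ∀ {j} → φ j ≈S oneS → MaRData.fs d j ≈S tS
      fs≈tS φ≈1 =
        ≈S.trans (*S-cong ≈S.refl (≈S.trans (inflate-cong ℓ φ≈1) (inflate-oneS ℓ))) (*S-identityʳ tS)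

      array≈identity : β ≈S oneS → γ ≈S oneS → (∀ i → φ i ≈S oneS) → array d ≈M identityM
      array≈identity β≈1 _   _   n zero    =
        trans (inflate-cong ℓ β≈1 n) (trans (inflate-oneS ℓ n) (oneS≈tPow0 n))
      array≈identity _   γ≈1 φ≈1 n (suc k) = begin
        column d (suc k) n
          ≈⟨ column≈ k n ⟩
        (tPow (suc k) *S inflate ℓ (powerProduct γ φ (e k))) n
          ≈⟨ *S-cong ≈S.refl (inflate-cong ℓ
               (≈S.trans (powerProduct-cong (e k) γ≈1 φ≈1) (powerProduct-oneS (e k)))) n ⟩
        (tPow (suc k) *S inflate ℓ oneS) n
          ≈⟨ *S-cong ≈S.refl (inflate-oneS ℓ) n ⟩
        (tPow (suc k) *S oneS) n
          ≈⟨ *S-identityʳ (tPow (suc k)) n ⟩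
        tPow (suc k) n ∎
        where open SetoidReasoning setoid

    module Product (d₁ d₂ : MaRData ℓ) where

      private
        module H₁ = Hats d₁
        module H₂ = Hats d₂
        module M₁ = MaRData d₁
        module M₂ = MaRData d₂

      β : Series
      β = mv H₁.Ĉ H₂.b̂

      γ : Series
      γ = H₁.ĝ *S (H₂.ĝ ∘S H₁.R)

      φ : Fin ℓ → Series
      φ i = H₁.f̂ i *S (H₂.f̂ i ∘S H₁.R)

      open FromHats β γ φ (*-≉0 (H₁.Ĉ-diag≉0 0) M₂.b0≉0)
                          (*S-≉0 {H₁.ĝ} {H₂.ĝ ∘S H₁.R} M₁.g0≉0 (∘S-≉0 {H₂.ĝ} H₁.R M₂.g0≉0))
                          (λ i → *S-≉0 {H₁.f̂ i} {H₂.f̂ i ∘S H₁.R} (M₁.fs1≉0 i) (∘S-≉0 {H₂.f̂ i} H₁.R (M₂.fs1≉0 i)))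
        public

      array-product : array d ≈M (array d₁ ·M array d₂)
      array-product n zero    =
        sym (trans (mv-cong {array d₁} (λ _ _ _ → refl) H₂.b≈ n) (H₁.array-inflate H₂.b̂ n))
      array-product n (suc k) = begin
        column d (suc k) n
          ≈⟨ column≈ k n ⟩
        (tPow (suc k) *S inflate ℓ (powerProduct γ φ (e k))) n
          ≈⟨ *S-cong ≈S.refl
               (inflate-cong ℓ (powerProduct-*S-∘S H₁.ĝ H₁.f̂ H₂.ĝ H₂.f̂ (e k) H₁.R-order)) n ⟨
        (tPow (suc k) *S inflate ℓ (H₁.Û k *S (H₂.Û k ∘S H₁.R))) n
          ≈⟨ H₁.array-action k (H₂.Û k) n ⟨
        mv (array d₁) (tPow (suc k) *S inflate ℓ (H₂.Û k)) n
          ≈⟨ mv-cong {array d₁} (λ _ _ _ → refl) (H₂.column-inflate k) n ⟨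
        (array d₁ ·M array d₂) n (suc k) ∎
        where open SetoidReasoning setoid

      product-InLhat : ∀ {j} → InLhat j d₁ → InLhat j d₂ → InLhat j d
      product-InLhat d₁∈L̂ⱼ d₂∈L̂ⱼ = fs≈tS (≈S.trans
        (*S-cong (H₁.f≈t⇒f̂≈1 d₁∈L̂ⱼ) (≈S.trans (∘S-cong (H₂.f≈t⇒f̂≈1 d₂∈L̂ⱼ) ≈S.refl) (oneS-∘S H₁.R-order)))
        (*S-identityˡ oneS))

    module Identity = FromHats oneS oneS (λ _ → oneS) 1≉0 1≉0 (λ _ → 1≉0)

    module Inverse (d : MaRData ℓ) (j : Fin ℓ) (d∈L̂ⱼ : InLhat j d) where

      open Hats d
      open MaRData d using (g0≉0; fs1≉0)

      private
        module Forward = ForwardSubstitution Ĉ Ĉ-diag≉0 oneS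

        solve-∘R : ∀ h → h 0 ≉ 0# → Σ Series (λ V → (h *S (V ∘S R)) ≈S oneS × V 0 ≉ 0#)
        solve-∘R h h0≉0 = ∘S-solve {h} {prodS ℓ f̂} h0≉0 (prodS-≉0 ℓ {f̂} fs1≉0)

      φ⁻¹-solution : ∀ i → Σ Series (λ V → (f̂ i *S (V ∘S R)) ≈S oneS × V 0 ≉ 0#)
      φ⁻¹-solution i with i Fin.≟ j
      ... | yes i≡j = oneS , ≈S.trans (*S-cong f̂ᵢ≈1 (oneS-∘S R-order)) (*S-identityˡ oneS) , 1≉0
        where
        f̂ᵢ≈1 : f̂ i ≈S oneS
        f̂ᵢ≈1 = f≈t⇒f̂≈1 (≡.subst (λ k → InLhat k d) (≡.sym i≡j) d∈L̂ⱼ)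
      ... | no  _   = solve-∘R (f̂ i) (fs1≉0 i)

      φ⁻¹ : Fin ℓ → Series
      φ⁻¹ i = proj₁ (φ⁻¹-solution i)

      φ⁻¹ⱼ≈1 : φ⁻¹ j ≈S oneS
      φ⁻¹ⱼ≈1 with j Fin.≟ j
      ... | yes _   = ≈S.refl
      ... | no j≢j = ⊥-elim (j≢j ≡.refl)

      γ-solution : Σ Series (λ V → (ĝ *S (V ∘S R)) ≈S oneS × V 0 ≉ 0#)
      γ-solution = solve-∘R ĝ g0≉0

      module D⁻¹ = FromHats Forward.solution (proj₁ γ-solution) φ⁻¹
                            (Forward.solution-≉0 1≉0) (proj₂ (proj₂ γ-solution)) (proj₂ ∘ proj₂ ∘ φ⁻¹-solution)
      module DD⁻¹ = Product d D⁻¹.d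

      d⁻¹ : MaRData ℓ
      d⁻¹ = D⁻¹.d

      d⁻¹-InLhat : InLhat j d⁻¹
      d⁻¹-InLhat = D⁻¹.fs≈tS {j} φ⁻¹ⱼ≈1

      rightInverse : (array d ·M array d⁻¹) ≈M identityM
      rightInverse n k = trans (sym (DD⁻¹.array-product n k)) (DD⁻¹.array≈identity β≈1 γ≈1 φ≈1 n k)
        where
        β≈1 : mv Ĉ (Hats.b̂ d⁻¹) ≈S oneS
        β≈1 = ≈S.trans (mv-cong {Ĉ} (λ _ _ _ → refl) D⁻¹.b̂≈β) Forward.solves
        γ≈1 : (ĝ *S (Hats.ĝ d⁻¹ ∘S R)) ≈S oneS
        γ≈1 = ≈S.trans (*S-cong ≈S.refl (∘S-cong D⁻¹.ĝ≈γ ≈S.refl)) (proj₁ (proj₂ γ-solution))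
        φ≈1 : ∀ i → (f̂ i *S (Hats.f̂ d⁻¹ i ∘S R)) ≈S oneS
        φ≈1 i = ≈S.trans (*S-cong ≈S.refl (∘S-cong (D⁻¹.f̂≈φ i) ≈S.refl)) (proj₁ (proj₂ (φ⁻¹-solution i)))

    subgroup : (j : Fin ℓ) → IsSubgroupMaR (InLhat j)
    subgroup j =
        (Identity.d , Identity.fs≈tS {j} ≈S.refl , Identity.array≈identity ≈S.refl ≈S.refl (λ _ → ≈S.refl))
      , (λ d₁ d₂ d₁∈L̂ⱼ d₂∈L̂ⱼ → let open Product d₁ d₂ in
           d , product-InLhat d₁∈L̂ⱼ d₂∈L̂ⱼ , array-product)
      , λ d d∈L̂ⱼ → let open Inverse d j d∈L̂ⱼ in
          d⁻¹ , d⁻¹-InLhat , rightInverse ,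
          ·M-inverseˡ (Hats.array-lowerTriangular d) (Hats.array-lowerTriangular d⁻¹)
                      rightInverse (Inverse.rightInverse d⁻¹ j d⁻¹-InLhat)

-- For ℓ = 2 the array itself is the witness: the Appell and
-- type-2 Bell subgroups are defined by exactly the conditions f₂ = t and f₂ = t g on the data.
theorem4p4 : ∀ {c r : Level} (F : Field c r) →
    let open Field F
        open FieldTheory F
    in CharacteristicZero →
       ((ℓ : ℕ) → 2 ≤ ℓ → (j : Fin ℓ) → IsSubgroupMaR (InLhat j))
       × (∀ (d : MaRData 2) → f₁ d ≈S tS →
            ((f₂ d ≈S tS → InAppellDAR (array d))
             × (f₂ d ≈S (tS *S MaRData.g d) → InBell2DAR (array d))))
theorem4p4 F _ =
    subgroups
  , λ d f₁≈t → (λ f₂≈t → d , f₁≈t , f₂≈t , λ _ _ → Field.refl F)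
             , (λ f₂≈tg → d , f₂≈tg , λ _ _ → Field.refl F)
  where
  subgroups : (ℓ : ℕ) → 2 ≤ ℓ → (j : Fin ℓ) → FieldTheory.IsSubgroupMaR F (FieldTheory.InLhat F j)
  subgroups (suc (suc p)) (s≤s (s≤s z≤n)) = subgroup F p
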